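{- Let $\theta_1\in M_0(F)$ with $\theta_1^2=1$, let $p=\dim_D V^{+}$, $q=\dim_D V^-$ for the $\pm1$-eigenspaces of $\theta_1$. Let $R$ be a parabolic subgroup of $G$ containing $P_0$, stabilizer of a flag $0=V_0\subsetneq V_1\subsetneq\cdots\subsetneq V_m=V$, and let $W_i$ ($1\le i\le m$) be the subspaces with $V_i=V_{i-1}\oplus W_i$ such that $M_R$ is the stabilizer of all $W_i$. Put $p_i=\dim_D(W_i\cap V^+)$, $q_i=\dim_D(W_i\cap V^-)$, $P_k=\sum_{i\le k}p_i$, $Q_k=\sum_{i\le k}q_i$. Then $R\in\mathcal F^{G,\flat}(P_0,\theta_1,\theta_1)$ if and only if for every $1\le k<m$ one has $P_k-Q_k=0$ or $P_k-Q_k=p-q$.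
   Context: $F$ is a number field, $D$ a central division algebra over $F$, $V=D^N$ with canonical basis $(e_1,\dots,e_N)$, $G=GL_D(V)$. $P_0$ is the stabilizer of the flag of spans of $(e_1,\dots,e_i)$, $1\le i\le N$ (upper triangular matrices), and $M_0$ the diagonal subgroup (stabilizer of the lines $e_iD$). For a parabolic $R\supset M_0$, $M_R$ denotes its Levi factor containing $M_0$, $N_R$ its unipotent radical, $A_R$ the maximal $F$-split central torus of $M_R$, $\mathfrak a_R=\mathrm{Hom}(X^*(A_R),\mathbb R)$ and $\mathfrak a_R^*=X^*(A_R)\otimes\mathbb R$. $\rho_R^G\in\mathfrak a_R^*$ is half the sum (with multiplicities) of the roots of $A_R$ on $\mathrm{Lie}(N_R)$. For $\theta_i\in M_0(F)$ of order at most $2$ with centralizer $G^{\theta_i}$, $R^{\theta_i}=R\cap G^{\theta_i}$ is a parabolic of $G^{\theta_i}$ with Levi factor $M_R^{\theta_i}$; $\rho_{R^{\theta_i}}^{G^{\theta_i}}$ is half the sum of the roots of $A_{R^{\theta_i}}$ (maximal split central torus of $M_R^{\theta_i}$) on $\mathrm{Lie}(N_{R^{\theta_i}})$; since $A_R\subset A_{R^{\theta_i}}$, its restriction to $\mathfrak a_R$, written $(\cdot)_R$, lies in $\mathfrak a_R^*$. Define $\mathcal F^{G,\flat}(P_0,\theta_1,\theta_2)$ as the set of parabolic subgroups $R\supset P_0$ of $G$ with $\rho_R^G=(\rho_{R^{\theta_1}}^{G^{\theta_1}}+\rho_{R^{\theta_2}}^{G^{\theta_2}})_R$. -}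

module Defs where

open import Data.Nat using (ℕ; zero; suc; _+_; _*_; _≤_; _<_; _<ᵇ_; _≤ᵇ_)
open import Data.Integer using (ℤ; +_) renaming (_-_ to _-ℤ_; _+_ to _+ℤ_)
open import Data.Fin using (Fin; toℕ) renaming (zero to fzero; suc to fsuc)
open import Data.Bool using (Bool; true; false; if_then_else_; _∧_; not)
open import Relation.Binary.PropositionalEquality using (_≡_)

Σℕ : ∀ {n} → (Fin n → ℕ) → ℕ
Σℕ {zero}  f = 0
Σℕ {suc n} f = f fzero + Σℕ (λ i → f (fsuc i))

-- A parabolic subgroup R ⊇ P₀ of G = GL_N(D), i.e. a standard flag
-- 0 = V₀ ⊊ V₁ ⊊ ... ⊊ V_m = D^N, V_i = span(e_1..e_{n_1+...+n_i}),
-- is determined by the composition (size i = dim_D W_i) of N.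
-- Blocks are indexed 0 .. m-1 (block i here is W_{i+1} of the paper).
record Parabolic (N : ℕ) : Set where
  field
    m        : ℕ
    size     : Fin m → ℕ
    size-pos : ∀ i → 1 ≤ size i
    size-sum : Σℕ size ≡ N
open Parabolic public

-- θ ∈ M₀(F) with θ² = 1: diagonal with entries ±1 (in a division algebra
-- x² = 1 forces x = ±1).  true ↦ +1, false ↦ -1.
Involution : ℕ → Set
Involution N = Fin N → Bool

module _ {N : ℕ} (R : Parabolic N) where
  offset : Fin (m R) → ℕ
  offset i = Σℕ (λ j → if toℕ j <ᵇ toℕ i then size R j else 0)

  inBlock : Fin (m R) → Fin N → Bool
  inBlock i s = (offset i ≤ᵇ toℕ s) ∧ (toℕ s <ᵇ offset i + size R i)

  plusDim : Involution N → Fin (m R) → ℕ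
  plusDim θ i = Σℕ (λ s → if inBlock i s ∧ θ s then 1 else 0)

  minusDim : Involution N → Fin (m R) → ℕ
  minusDim θ i = Σℕ (λ s → if inBlock i s ∧ not (θ s) then 1 else 0)

-- Elements of 𝔞_R^* = X*(A_R) ⊗ ℝ are written in the basis e_0..e_{m-1},
-- e_i = the character "scalar on block i" of A_R ≅ G_m^m.
-- Given a multiplicity for each pair i < j of the (restricted) root
-- e_i - e_j, twoRho mult = Σ_{i<j} mult i j · (e_i - e_j)   (= 2ρ).
twoRho : ∀ {m} → (Fin m → Fin m → ℕ) → Fin m → ℤ
twoRho mult k =
  (+ Σℕ (λ j → if toℕ k <ᵇ toℕ j then mult k j else 0))
  -ℤ (+ Σℕ (λ i → if toℕ i <ᵇ toℕ k then mult i k else 0))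

module _ (d : ℕ) {N : ℕ} (R : Parabolic N) where
  -- d = degree of D over F (dim_F D = d²).
  -- 2ρ_R^G: the roots of A_R on Lie(N_R) are e_i - e_j (i<j), with
  -- multiplicity dim_F Hom_D(W_j , W_i) = d² n_i n_j.
  twoRhoG : Fin (m R) → ℤ
  twoRhoG = twoRho (λ i j → d * d * size R i * size R j)

  -- (2ρ_{R^θ}^{G^θ})_R : G^θ = GL(V⁺) × GL(V⁻); roots of A_{R^θ} on
  -- Lie(N_{R^θ}) are f_{i,±} - f_{j,±} (i<j) with multiplicities
  -- d² p_i p_j, resp. d² q_i q_j; each f_{i,±} restricts to e_i on A_R.
  twoRhoθR : Involution N → Fin (m R) → ℤ
  twoRhoθR θ = twoRho (λ i j → d * d * (plusDim R θ i * plusDim R θ j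
                                         + minusDim R θ i * minusDim R θ j))

  -- R ∈ F^{G,♭}(P₀,θ₁,θ₂)  ⇔  ρ_R^G = (ρ^{θ₁} + ρ^{θ₂})_R
  -- (equivalently after multiplying by 2).
  IsFlat : Involution N → Involution N → Set
  IsFlat θ₁ θ₂ = ∀ k → twoRhoG k ≡ twoRhoθR θ₁ k +ℤ twoRhoθR θ₂ k

dimPlus : ∀ {N} → Involution N → ℕ
dimPlus θ = Σℕ (λ s → if θ s then 1 else 0)

dimMinus : ∀ {N} → Involution N → ℕ
dimMinus θ = Σℕ (λ s → if θ s then 0 else 1)

-- P_k = Σ_{i ≤ k} p_i, Q_k = Σ_{i ≤ k} q_i (0-based k)
partialPlus : ∀ {N} (R : Parabolic N) → Involution N → Fin (m R) → ℕ
partialPlus R θ k = Σℕ (λ i → if toℕ i ≤ᵇ toℕ k then plusDim R θ i else 0)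

partialMinus : ∀ {N} (R : Parabolic N) → Involution N → Fin (m R) → ℕ
partialMinus R θ k = Σℕ (λ i → if toℕ i ≤ᵇ toℕ k then minusDim R θ i else 0)

{-# OPTIONS --safe #-}
-- Let p_i, q_i be the dimensions of W_i ∩ V^±, n_i = p_i + q_i, D_i = p_i − q_i, and
-- S_t = Σ_{i<t} D_i, so that S_0 = 0, S_m = p − q and P_k − Q_k = S_k.  In the basis e_i of 𝔞_R^*,
-- 2ρ of a root multiplicity μ has k-th coordinate Σ_{j>k} μ_kj − Σ_{i<k} μ_ik, which is linear
-- in μ.  The identity n_i n_j + D_i D_j = 2 (p_i p_j + q_i q_j) therefore gives
--   2ρ_R^G + 2ρ(d² D_i D_j) = 2 (ρ^θ + ρ^θ)_R,
-- and the rank-one multiplicity d² D_i D_j contributes d² D_k (Σ_{j>k} D_j − Σ_{j<k} D_j)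
-- = d² (S_{k+1} − S_k) (p − q − S_k − S_{k+1}) to coordinate k.  So R is flat iff at each step the
-- partial sums either stay (S_{k+1} = S_k) or reflect (S_k + S_{k+1} = p − q), and starting from
-- S_0 = 0 this holds iff every S_k lies in {0, p − q}.

module Submission where

open import Defs
open import Data.Nat using (ℕ; suc; _≤_; _<_)
open import Data.Integer using (ℤ; +_; _-_)
open import Data.Fin using (Fin; toℕ)
open import Data.Sum using (_⊎_)
open import Function.Bundles using (_⇔_)
open import Relation.Binary.PropositionalEquality using (_≡_)

open import Algebra.Bundles using (CommutativeMonoid)
open import Data.Bool using (Bool; true; false; if_then_else_; _∧_; not; T)
open import Data.Bool.Properties using (if-float; if-not)
open import Data.Empty using (⊥-elim)
open import Data.Fin using (zero; suc; fromℕ<)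
open import Data.Fin.Properties using (toℕ<n; toℕ-fromℕ<)
open import Data.Integer using (0ℤ) renaming (_+_ to _+ℤ_; _*_ to _*ℤ_)
import Data.Integer as ℤ
open import Data.Integer.Tactic.RingSolver using (solve-∀)
open import Data.Nat using (zero; _+_; _*_; _<ᵇ_; _≤ᵇ_; z≤n; s≤s)
open import Data.Sum using (inj₁; inj₂)
open import Data.Unit using (tt)
open import Function using (_∘_; mk⇔; Equivalence)
open import Relation.Binary.PropositionalEquality
  using (_≢_; refl; sym; trans; cong; cong₂; subst; module ≡-Reasoning)
import Algebra.Properties.AbelianGroup as AbelianGroupProperties
import Algebra.Properties.Semiring.Sum as SemiringSum
import Data.Integer.Properties as ℤₚ
import Data.Nat.Properties as ℕₚ
import Function.Properties.Equivalence as ⇔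
open import Function.Related.TypeIsomorphisms using (→-cong-⇔)

module RestrictedSums {c ℓ} (M : CommutativeMonoid c ℓ) where
  open CommutativeMonoid M
    renaming (_∙_ to _+ᴹ_; ε to 0#; ∙-congˡ to +-congˡ; ∙-congʳ to +-congʳ; assoc to +-assoc;
              identityˡ to +-identityˡ; identityʳ to +-identityʳ; refl to ≈-refl; sym to ≈-sym;
              trans to ≈-trans)
  open import Algebra.Properties.CommutativeMonoid.Sum M public
  open import Relation.Binary.Reasoning.Setoid setoid

  sumWhere : ∀ {n} → (Fin n → Bool) → (Fin n → Carrier) → Carrier
  sumWhere p x = sum (λ j → if p j then x j else 0#)

  prefix : ∀ {n} → (Fin n → Carrier) → ℕ → Carrier
  prefix x t = sumWhere (λ j → toℕ j <ᵇ t) x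

  suffix : ∀ {n} → (Fin n → Carrier) → Fin n → Carrier
  suffix x k = sumWhere (λ j → toℕ k <ᵇ toℕ j) x

  sumWhere-cong : ∀ {n} (p : Fin n → Bool) {x y : Fin n → Carrier} →
                  (∀ j → x j ≈ y j) → sumWhere p x ≈ sumWhere p y
  sumWhere-cong p x≈y = sum-cong-≋ (λ j → guard-cong (p j) (x≈y j))
    where
    guard-cong : ∀ b {u v} → u ≈ v → (if b then u else 0#) ≈ (if b then v else 0#)
    guard-cong true  u≈v = u≈v
    guard-cong false _   = ≈-refl

  sumWhere-distrib-+ : ∀ {n} (p : Fin n → Bool) (x y : Fin n → Carrier) →
                       sumWhere p (λ j → x j +ᴹ y j) ≈ sumWhere p x +ᴹ sumWhere p y
  sumWhere-distrib-+ p x y =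
    ≈-trans (sum-cong-≋ (λ j → guard-+ (p j)))
            (∑-distrib-+ (λ j → if p j then x j else 0#) (λ j → if p j then y j else 0#))
    where
    guard-+ : ∀ b {u v} → (if b then u +ᴹ v else 0#) ≈ (if b then u else 0#) +ᴹ (if b then v else 0#)
    guard-+ true  = ≈-refl
    guard-+ false = ≈-sym (+-identityˡ 0#)

  prefix-zero : ∀ {n} (x : Fin n → Carrier) → prefix x 0 ≈ 0#
  prefix-zero {n} x = sum-replicate-zero n

  prefix-suc : ∀ {n} (x : Fin n → Carrier) k → prefix x (suc (toℕ k)) ≈ prefix x (toℕ k) +ᴹ x k
  prefix-suc x zero = begin
    x zero +ᴹ prefix (x ∘ suc) 0  ≈⟨ +-congˡ (prefix-zero (x ∘ suc)) ⟩
    x zero +ᴹ 0#                  ≈⟨ +-identityʳ _ ⟩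
    x zero                        ≈⟨ +-identityˡ _ ⟨
    0# +ᴹ x zero                  ≈⟨ +-congʳ (prefix-zero x) ⟨
    prefix x 0 +ᴹ x zero          ∎
  prefix-suc x (suc k) = begin
    x zero +ᴹ prefix (x ∘ suc) (suc (toℕ k))       ≈⟨ +-congˡ (prefix-suc (x ∘ suc) k) ⟩
    x zero +ᴹ (prefix (x ∘ suc) (toℕ k) +ᴹ x (suc k)) ≈⟨ +-assoc _ _ _ ⟨
    x zero +ᴹ prefix (x ∘ suc) (toℕ k) +ᴹ x (suc k)   ∎

  prefix-full : ∀ {n} (x : Fin n → Carrier) {t} → n ≤ t → prefix x t ≈ sum x
  prefix-full {zero}  x         _         = ≈-refl
  prefix-full {suc n} x {suc t} (s≤s n≤t) = +-congˡ (prefix-full (x ∘ suc) n≤t)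

  sum-split : ∀ {n} (x : Fin n → Carrier) k → sum x ≈ prefix x (toℕ k) +ᴹ x k +ᴹ suffix x k
  sum-split x zero = begin
    x zero +ᴹ sum (x ∘ suc)                      ≈⟨ +-congʳ (+-identityˡ _) ⟨
    0# +ᴹ x zero +ᴹ sum (x ∘ suc)                ≈⟨ +-congʳ (+-congʳ (prefix-zero x)) ⟨
    prefix x 0 +ᴹ x zero +ᴹ sum (x ∘ suc)        ≈⟨ +-congˡ (+-identityˡ _) ⟨
    prefix x 0 +ᴹ x zero +ᴹ (0# +ᴹ sum (x ∘ suc)) ∎
  sum-split x (suc k) = begin
    x zero +ᴹ sum (x ∘ suc)                  ≈⟨ +-congˡ (sum-split (x ∘ suc) k) ⟩
    x zero +ᴹ (B +ᴹ x (suc k) +ᴹ A)          ≈⟨ +-assoc _ _ _ ⟨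
    x zero +ᴹ (B +ᴹ x (suc k)) +ᴹ A          ≈⟨ +-congʳ (+-assoc _ _ _) ⟨
    x zero +ᴹ B +ᴹ x (suc k) +ᴹ A            ≈⟨ +-congˡ (+-identityˡ A) ⟨
    x zero +ᴹ B +ᴹ x (suc k) +ᴹ (0# +ᴹ A)    ∎
    where
    B = prefix (x ∘ suc) (toℕ k)
    A = suffix (x ∘ suc) k

module ℕΣ = RestrictedSums ℕₚ.+-0-commutativeMonoid
module ℤΣ = RestrictedSums ℤₚ.+-0-commutativeMonoid
open SemiringSum ℤₚ.+-*-semiring using (*-distribˡ-sum)
open AbelianGroupProperties ℤₚ.+-0-abelianGroup using (identityʳ-unique)

-- Dimensions of the eigenspaces in the blocks

Σℕ≡sum : ∀ {n} (f : Fin n → ℕ) → Σℕ f ≡ ℕΣ.sum f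
Σℕ≡sum {zero}  f = refl
Σℕ≡sum {suc n} f = cong (_+_ (f zero)) (Σℕ≡sum (f ∘ suc))

prefix≤sum : ∀ {n} (x : Fin n → ℕ) t → ℕΣ.prefix x t ≤ ℕΣ.sum x
prefix≤sum {zero}  x t       = z≤n
prefix≤sum {suc n} x zero    = ℕₚ.≤-trans (ℕₚ.≤-reflexive (ℕΣ.prefix-zero x)) z≤n
prefix≤sum {suc n} x (suc t) = ℕₚ.+-monoʳ-≤ (x zero) (prefix≤sum (x ∘ suc) t)

telescope : ∀ {m} (g : ℕ → ℕ) (h : Fin m → ℕ) →
            (∀ i → g (suc (toℕ i)) ≡ g (toℕ i) + h i) → g m ≡ g 0 + ℕΣ.sum h
telescope {zero}  g h step = sym (ℕₚ.+-identityʳ (g 0))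
telescope {suc m} g h step = begin
  g (suc m)                         ≡⟨ telescope (g ∘ suc) (h ∘ suc) (step ∘ suc) ⟩
  g 1 + ℕΣ.sum (h ∘ suc)            ≡⟨ cong (_+ ℕΣ.sum (h ∘ suc)) (step zero) ⟩
  g 0 + h zero + ℕΣ.sum (h ∘ suc)   ≡⟨ ℕₚ.+-assoc (g 0) (h zero) _ ⟩
  g 0 + ℕΣ.sum h                    ∎
  where open ≡-Reasoning

≤ᵇ≡not<ᵇ : ∀ m n → (m ≤ᵇ n) ≡ not (n <ᵇ m)
≤ᵇ≡not<ᵇ zero          n       = refl
≤ᵇ≡not<ᵇ (suc m)       zero    = refl
≤ᵇ≡not<ᵇ (suc zero)    (suc n) = refl
≤ᵇ≡not<ᵇ (suc (suc m)) (suc n) = ≤ᵇ≡not<ᵇ (suc m) n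

≤ᵇ≡<ᵇsuc : ∀ m n → (m ≤ᵇ n) ≡ (m <ᵇ suc n)
≤ᵇ≡<ᵇsuc zero    n = refl
≤ᵇ≡<ᵇsuc (suc m) n = refl

<ᵇ-monoʳ : ∀ s {a b} → a ≤ b → T (s <ᵇ a) → T (s <ᵇ b)
<ᵇ-monoʳ s {a} a≤b = ℕₚ.<⇒<ᵇ ∘ (λ s<a → ℕₚ.<-≤-trans s<a a≤b) ∘ ℕₚ.<ᵇ⇒< s a

χ : Bool → ℕ
χ b = if b then 1 else 0

χ-interval : ∀ x y P → (T x → T y) →
             (if x then χ P else 0) + χ ((not x ∧ y) ∧ P) ≡ (if y then χ P else 0)
χ-interval false true  P _   = refl
χ-interval false false P _   = refl
χ-interval true  true  P _   = ℕₚ.+-identityʳ (χ P)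
χ-interval true  false P x⇒y = ⊥-elim (x⇒y tt)

χ-complement : ∀ b P → χ (b ∧ P) + χ (b ∧ not P) ≡ χ (b ∧ true)
χ-complement false P     = refl
χ-complement true  true  = refl
χ-complement true  false = refl

count : ∀ {N} → (Fin N → Bool) → ℕ → ℕ
count P = ℕΣ.prefix (χ ∘ P)

countIn : ∀ {N} → (Fin N → Bool) → ℕ → ℕ → ℕ
countIn P a b = ℕΣ.sum (λ s → χ (((a ≤ᵇ toℕ s) ∧ (toℕ s <ᵇ b)) ∧ P s))

count-split : ∀ {N} (P : Fin N → Bool) {a b} → a ≤ b → count P a + countIn P a b ≡ count P b
count-split P {a} {b} a≤b =
  trans (sym (ℕΣ.∑-distrib-+ (λ s → if toℕ s <ᵇ a then χ (P s) else 0) _))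
        (ℕΣ.sum-cong-≗ split-at)
  where
  split-at : ∀ s → (if toℕ s <ᵇ a then χ (P s) else 0) + χ (((a ≤ᵇ toℕ s) ∧ (toℕ s <ᵇ b)) ∧ P s)
                   ≡ (if toℕ s <ᵇ b then χ (P s) else 0)
  split-at s rewrite ≤ᵇ≡not<ᵇ a (toℕ s) =
    χ-interval (toℕ s <ᵇ a) (toℕ s <ᵇ b) (P s) (<ᵇ-monoʳ (toℕ s) a≤b)

countIn-complement : ∀ {N} (P : Fin N → Bool) a b →
                     countIn P a b + countIn (not ∘ P) a b ≡ countIn {N} (λ _ → true) a b
countIn-complement {N} P a b =
  trans (sym (ℕΣ.∑-distrib-+ (λ s → χ (inside s ∧ P s)) (λ s → χ (inside s ∧ not (P s)))))
        (ℕΣ.sum-cong-≗ (λ s → χ-complement (inside s) (P s)))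
  where
  inside : Fin N → Bool
  inside s = (a ≤ᵇ toℕ s) ∧ (toℕ s <ᵇ b)

count-true : ∀ {N} x → x ≤ N → count {N} (λ _ → true) x ≡ x
count-true {zero}  zero    _         = refl
count-true {suc N} zero    _         = ℕΣ.prefix-zero (λ (_ : Fin (suc N)) → 1)
count-true {suc N} (suc x) (s≤s x≤N) = cong suc (count-true x x≤N)

module Blocks {N : ℕ} (R : Parabolic N) where

  offsets : ℕ → ℕ
  offsets = ℕΣ.prefix (size R)

  blockEnd : Fin (m R) → ℕ
  blockEnd i = offset R i + size R i

  offset≤blockEnd : ∀ i → offset R i ≤ blockEnd i
  offset≤blockEnd i = ℕₚ.m≤m+n (offset R i) (size R i)

  offset≡offsets : ∀ i → offset R i ≡ offsets (toℕ i)
  offset≡offsets i = Σℕ≡sum (λ j → if toℕ j <ᵇ toℕ i then size R j else 0)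

  blockEnd≡offsets : ∀ i → blockEnd i ≡ offsets (suc (toℕ i))
  blockEnd≡offsets i =
    trans (cong (_+ size R i) (offset≡offsets i)) (sym (ℕΣ.prefix-suc (size R) i))

  sum-size : ℕΣ.sum (size R) ≡ N
  sum-size = trans (sym (Σℕ≡sum (size R))) (size-sum R)

  offsets-end : offsets (m R) ≡ N
  offsets-end = trans (ℕΣ.prefix-full (size R) ℕₚ.≤-refl) sum-size

  blockEnd≤N : ∀ i → blockEnd i ≤ N
  blockEnd≤N i = begin
    blockEnd i             ≡⟨ blockEnd≡offsets i ⟩
    offsets (suc (toℕ i))  ≤⟨ prefix≤sum (size R) (suc (toℕ i)) ⟩
    ℕΣ.sum (size R)        ≡⟨ sum-size ⟩
    N                      ∎
    where open ℕₚ.≤-Reasoning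

  countIn-true : ∀ i → countIn {N} (λ _ → true) (offset R i) (blockEnd i) ≡ size R i
  countIn-true i = ℕₚ.+-cancelˡ-≡ (offset R i) _ _ (begin
    offset R i + countIn all (offset R i) (blockEnd i)
      ≡⟨ cong (_+ countIn all (offset R i) (blockEnd i)) (count-true _ offset≤N) ⟨
    count all (offset R i) + countIn all (offset R i) (blockEnd i)
      ≡⟨ count-split all (offset≤blockEnd i) ⟩
    count all (blockEnd i)
      ≡⟨ count-true _ (blockEnd≤N i) ⟩
    blockEnd i ∎)
    where
    open ≡-Reasoning
    all : Fin N → Bool
    all _ = true
    offset≤N : offset R i ≤ N
    offset≤N = ℕₚ.≤-trans (offset≤blockEnd i) (blockEnd≤N i)

  sum-countIn : ∀ (P : Fin N → Bool) →
                ℕΣ.sum (λ i → countIn P (offset R i) (blockEnd i)) ≡ ℕΣ.sum (χ ∘ P)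
  sum-countIn P = begin
    ℕΣ.sum blockCount                   ≡⟨ cong (_+ ℕΣ.sum blockCount) countBefore-start ⟨
    countBefore 0 + ℕΣ.sum blockCount   ≡⟨ telescope countBefore blockCount step ⟨
    countBefore (m R)                   ≡⟨ cong (count P) offsets-end ⟩
    count P N                           ≡⟨ ℕΣ.prefix-full (χ ∘ P) ℕₚ.≤-refl ⟩
    ℕΣ.sum (χ ∘ P)                      ∎
    where
    open ≡-Reasoning
    blockCount : Fin (m R) → ℕ
    blockCount i = countIn P (offset R i) (blockEnd i)

    countBefore : ℕ → ℕ
    countBefore = count P ∘ offsets

    countBefore-start : countBefore 0 ≡ 0
    countBefore-start = trans (cong (count P) (ℕΣ.prefix-zero (size R))) (ℕΣ.prefix-zero (χ ∘ P))

    step : ∀ i → countBefore (suc (toℕ i)) ≡ countBefore (toℕ i) + blockCount i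
    step i = begin
      count P (offsets (suc (toℕ i)))  ≡⟨ cong (count P) (blockEnd≡offsets i) ⟨
      count P (blockEnd i)             ≡⟨ count-split P (offset≤blockEnd i) ⟨
      count P (offset R i) + blockCount i ≡⟨ cong (λ o → count P o + blockCount i) (offset≡offsets i) ⟩
      countBefore (toℕ i) + blockCount i  ∎

  module _ (θ : Involution N) where

    plusDim≡countIn : ∀ i → plusDim R θ i ≡ countIn θ (offset R i) (blockEnd i)
    plusDim≡countIn i = Σℕ≡sum (λ s → χ (inBlock R i s ∧ θ s))

    minusDim≡countIn : ∀ i → minusDim R θ i ≡ countIn (not ∘ θ) (offset R i) (blockEnd i)
    minusDim≡countIn i = Σℕ≡sum (λ s → χ (inBlock R i s ∧ not (θ s)))

    plusDim+minusDim : ∀ i → plusDim R θ i + minusDim R θ i ≡ size R i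
    plusDim+minusDim i = begin
      plusDim R θ i + minusDim R θ i
        ≡⟨ cong₂ _+_ (plusDim≡countIn i) (minusDim≡countIn i) ⟩
      countIn θ (offset R i) (blockEnd i) + countIn (not ∘ θ) (offset R i) (blockEnd i)
        ≡⟨ countIn-complement θ (offset R i) (blockEnd i) ⟩
      countIn {N} (λ _ → true) (offset R i) (blockEnd i)
        ≡⟨ countIn-true i ⟩
      size R i ∎
      where open ≡-Reasoning

    sum-plusDim : ℕΣ.sum (plusDim R θ) ≡ dimPlus θ
    sum-plusDim = begin
      ℕΣ.sum (plusDim R θ)                               ≡⟨ ℕΣ.sum-cong-≗ plusDim≡countIn ⟩
      ℕΣ.sum (λ i → countIn θ (offset R i) (blockEnd i))  ≡⟨ sum-countIn θ ⟩
      ℕΣ.sum (χ ∘ θ)                                     ≡⟨ Σℕ≡sum (χ ∘ θ) ⟨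
      dimPlus θ                                          ∎
      where open ≡-Reasoning

    sum-minusDim : ℕΣ.sum (minusDim R θ) ≡ dimMinus θ
    sum-minusDim = begin
      ℕΣ.sum (minusDim R θ)                                     ≡⟨ ℕΣ.sum-cong-≗ minusDim≡countIn ⟩
      ℕΣ.sum (λ i → countIn (not ∘ θ) (offset R i) (blockEnd i)) ≡⟨ sum-countIn (not ∘ θ) ⟩
      ℕΣ.sum (χ ∘ not ∘ θ)                                      ≡⟨ ℕΣ.sum-cong-≗ (λ s → if-not (θ s)) ⟩
      ℕΣ.sum (λ s → if θ s then 0 else 1)                        ≡⟨ Σℕ≡sum (λ s → if θ s then 0 else 1) ⟨
      dimMinus θ                                                ∎
      where open ≡-Reasoning

-- The vector 2ρ of a root multiplicity

+-Σℕ : ∀ {n} (f : Fin n → ℕ) → + Σℕ f ≡ ℤΣ.sum (+_ ∘ f)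
+-Σℕ {zero}  f = refl
+-Σℕ {suc n} f = trans (ℤₚ.pos-+ (f zero) (Σℕ (f ∘ suc))) (cong (_+ℤ_ (+ f zero)) (+-Σℕ (f ∘ suc)))

+-Σℕ-where : ∀ {n} (p : Fin n → Bool) (f : Fin n → ℕ) →
             + Σℕ (λ j → if p j then f j else 0) ≡ ℤΣ.sumWhere p (+_ ∘ f)
+-Σℕ-where p f = trans (+-Σℕ (λ j → if p j then f j else 0)) (ℤΣ.sum-cong-≗ (λ j → if-float +_ (p j)))

sumWhere-*ˡ : ∀ {n} (p : Fin n → Bool) a (x : Fin n → ℤ) →
              ℤΣ.sumWhere p (λ j → a *ℤ x j) ≡ a *ℤ ℤΣ.sumWhere p x
sumWhere-*ˡ p a x =
  trans (ℤΣ.sum-cong-≗ (λ j → guard-* (p j))) (sym (*-distribˡ-sum a (λ j → if p j then x j else 0ℤ)))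
  where
  guard-* : ∀ b {u} → (if b then a *ℤ u else 0ℤ) ≡ a *ℤ (if b then u else 0ℤ)
  guard-* true  = refl
  guard-* false = sym (ℤₚ.*-zeroʳ a)

sumWhere-distrib-- : ∀ {n} (p : Fin n → Bool) (x y : Fin n → ℤ) →
                     ℤΣ.sumWhere p (λ j → x j - y j) ≡ ℤΣ.sumWhere p x - ℤΣ.sumWhere p y
sumWhere-distrib-- p x y = begin
  ℤΣ.sumWhere p (λ j → x j - y j)                          ≡⟨ ℤΣ.sumWhere-distrib-+ p x (λ j → ℤ.- y j) ⟩
  ℤΣ.sumWhere p x +ℤ ℤΣ.sumWhere p (λ j → ℤ.- y j)          ≡⟨ cong (ℤΣ.sumWhere p x +ℤ_) negate ⟩
  ℤΣ.sumWhere p x - ℤΣ.sumWhere p y                        ∎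
  where
  open ≡-Reasoning
  negate : ℤΣ.sumWhere p (λ j → ℤ.- y j) ≡ ℤ.- ℤΣ.sumWhere p y
  negate = begin
    ℤΣ.sumWhere p (λ j → ℤ.- y j)        ≡⟨ ℤΣ.sumWhere-cong p (λ j → sym (ℤₚ.-1*i≡-i (y j))) ⟩
    ℤΣ.sumWhere p (λ j → ℤ.-1ℤ *ℤ y j)    ≡⟨ sumWhere-*ˡ p ℤ.-1ℤ y ⟩
    ℤ.-1ℤ *ℤ ℤΣ.sumWhere p y               ≡⟨ ℤₚ.-1*i≡-i _ ⟩
    ℤ.- ℤΣ.sumWhere p y                   ∎

twoRhoℤ : ∀ {m} → (Fin m → Fin m → ℤ) → Fin m → ℤ
twoRhoℤ μ k = ℤΣ.suffix (μ k) k - ℤΣ.prefix (λ i → μ i k) (toℕ k)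

module _ {m : ℕ} where

  twoRho≡twoRhoℤ : (mult : Fin m → Fin m → ℕ) → ∀ k → twoRho mult k ≡ twoRhoℤ (λ i j → + mult i j) k
  twoRho≡twoRhoℤ mult k =
    cong₂ _-_ (+-Σℕ-where (λ j → toℕ k <ᵇ toℕ j) (mult k))
              (+-Σℕ-where (λ i → toℕ i <ᵇ toℕ k) (λ i → mult i k))

  twoRhoℤ-cong : {μ ν : Fin m → Fin m → ℤ} → (∀ i j → μ i j ≡ ν i j) → ∀ k → twoRhoℤ μ k ≡ twoRhoℤ ν k
  twoRhoℤ-cong μ≡ν k =
    cong₂ _-_ (ℤΣ.sumWhere-cong _ (μ≡ν k)) (ℤΣ.sumWhere-cong _ (λ i → μ≡ν i k))

  twoRhoℤ-+ : (μ ν : Fin m → Fin m → ℤ) →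
              ∀ k → twoRhoℤ (λ i j → μ i j +ℤ ν i j) k ≡ twoRhoℤ μ k +ℤ twoRhoℤ ν k
  twoRhoℤ-+ μ ν k =
    trans (cong₂ _-_ (ℤΣ.sumWhere-distrib-+ _ (μ k) (ν k))
                     (ℤΣ.sumWhere-distrib-+ _ (λ i → μ i k) (λ i → ν i k)))
          (interchange (ℤΣ.suffix (μ k) k) (ℤΣ.suffix (ν k) k)
                       (ℤΣ.prefix (λ i → μ i k) (toℕ k)) (ℤΣ.prefix (λ i → ν i k) (toℕ k)))
    where
    interchange : ∀ a b c d → (a +ℤ b) - (c +ℤ d) ≡ (a - c) +ℤ (b - d)
    interchange = solve-∀

  twoRhoℤ-rankOne : ∀ a (u : Fin m → ℤ) k →
    twoRhoℤ (λ i j → a *ℤ (u i *ℤ u j)) k ≡ a *ℤ (u k *ℤ (ℤΣ.suffix u k - ℤΣ.prefix u (toℕ k)))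
  twoRhoℤ-rankOne a u k = begin
    ℤΣ.suffix (λ j → a *ℤ (u k *ℤ u j)) k - ℤΣ.prefix (λ i → a *ℤ (u i *ℤ u k)) (toℕ k)
      ≡⟨ cong₂ _-_ (ℤΣ.sumWhere-cong _ (λ j → reassoc a (u k) (u j)))
                   (ℤΣ.sumWhere-cong _ (λ i → reorder a (u i) (u k))) ⟩
    ℤΣ.suffix (λ j → a *ℤ u k *ℤ u j) k - ℤΣ.prefix (λ i → a *ℤ u k *ℤ u i) (toℕ k)
      ≡⟨ cong₂ _-_ (sumWhere-*ˡ _ (a *ℤ u k) u) (sumWhere-*ˡ _ (a *ℤ u k) u) ⟩
    a *ℤ u k *ℤ ℤΣ.suffix u k - a *ℤ u k *ℤ ℤΣ.prefix u (toℕ k)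
      ≡⟨ factor a (u k) _ _ ⟩
    a *ℤ (u k *ℤ (ℤΣ.suffix u k - ℤΣ.prefix u (toℕ k))) ∎
    where
    open ≡-Reasoning
    reassoc : ∀ a x y → a *ℤ (x *ℤ y) ≡ a *ℤ x *ℤ y
    reassoc = solve-∀
    reorder : ∀ a x y → a *ℤ (x *ℤ y) ≡ a *ℤ y *ℤ x
    reorder = solve-∀
    factor : ∀ a x s t → a *ℤ x *ℤ s - a *ℤ x *ℤ t ≡ a *ℤ (x *ℤ (s - t))
    factor = solve-∀

-- Partial sums that stay or reflect

ZeroOr : ℤ → ℤ → Set
ZeroOr t x = x ≡ 0ℤ ⊎ x ≡ t

StayOrReflect : ℤ → ℤ → ℤ → Set
StayOrReflect t a b = b ≡ a ⊎ a +ℤ b ≡ t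

module _ {t : ℤ} where

  stayOrReflect-preserves-zeroOr : ∀ {a b} → ZeroOr t a → StayOrReflect t a b → ZeroOr t b
  stayOrReflect-preserves-zeroOr a-zeroOr   (inj₁ refl)  = a-zeroOr
  stayOrReflect-preserves-zeroOr (inj₁ refl) (inj₂ 0+b≡t) = inj₂ (trans (sym (ℤₚ.+-identityˡ _)) 0+b≡t)
  stayOrReflect-preserves-zeroOr (inj₂ refl) (inj₂ t+b≡t) = inj₁ (identityʳ-unique t _ t+b≡t)

  zeroOr⇒stayOrReflect : ∀ {a b} → ZeroOr t a → ZeroOr t b → StayOrReflect t a b
  zeroOr⇒stayOrReflect (inj₁ refl) (inj₁ refl) = inj₁ refl
  zeroOr⇒stayOrReflect (inj₁ refl) (inj₂ refl) = inj₂ (ℤₚ.+-identityˡ t)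
  zeroOr⇒stayOrReflect (inj₂ refl) (inj₁ refl) = inj₂ (ℤₚ.+-identityʳ t)
  zeroOr⇒stayOrReflect (inj₂ refl) (inj₂ refl) = inj₁ refl

  defect≡0⇔stayOrReflect : ∀ {c} a b → c ≢ 0ℤ →
                           (c *ℤ ((b - a) *ℤ (t - (a +ℤ b))) ≡ 0ℤ) ⇔ StayOrReflect t a b
  defect≡0⇔stayOrReflect {c} a b c≢0 = mk⇔ to from
    where
    to : c *ℤ ((b - a) *ℤ (t - (a +ℤ b))) ≡ 0ℤ → StayOrReflect t a b
    to defect≡0 with ℤₚ.i*j≡0⇒i≡0∨j≡0 c defect≡0
    ... | inj₁ c≡0 = ⊥-elim (c≢0 c≡0)
    ... | inj₂ product≡0 with ℤₚ.i*j≡0⇒i≡0∨j≡0 (b - a) product≡0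
    ...   | inj₁ b-a≡0  = inj₁ (ℤₚ.i-j≡0⇒i≡j b a b-a≡0)
    ...   | inj₂ t-ab≡0 = inj₂ (sym (ℤₚ.i-j≡0⇒i≡j t (a +ℤ b) t-ab≡0))
    from : StayOrReflect t a b → c *ℤ ((b - a) *ℤ (t - (a +ℤ b))) ≡ 0ℤ
    from (inj₁ refl) rewrite ℤₚ.+-inverseʳ a
      = trans (cong (c *ℤ_) (ℤₚ.*-zeroˡ (t - (a +ℤ a)))) (ℤₚ.*-zeroʳ c)
    from (inj₂ refl) rewrite ℤₚ.+-inverseʳ (a +ℤ b)
      = trans (cong (c *ℤ_) (ℤₚ.*-zeroʳ (b - a))) (ℤₚ.*-zeroʳ c)

x+y≡z⇒x≡z⇔y≡0 : ∀ {x y z : ℤ} → x +ℤ y ≡ z → (x ≡ z ⇔ y ≡ 0ℤ)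
x+y≡z⇒x≡z⇔y≡0 {x} {y} x+y≡z = mk⇔
  (λ x≡z → identityʳ-unique x y (trans x+y≡z (sym x≡z)))
  (λ y≡0 → trans (sym (ℤₚ.+-identityʳ x)) (trans (cong (x +ℤ_) (sym y≡0)) x+y≡z))

∀-cong-⇔ : ∀ {a b c} {I : Set a} {A : I → Set b} {B : I → Set c} →
           (∀ i → A i ⇔ B i) → (∀ i → A i) ⇔ (∀ i → B i)
∀-cong-⇔ A⇔B = mk⇔ (λ f i → Equivalence.to (A⇔B i) (f i)) (λ g i → Equivalence.from (A⇔B i) (g i))

subst-⇔ : ∀ {a p} {A : Set a} (P : A → Set p) {x y} → x ≡ y → P x ⇔ P y
subst-⇔ P refl = ⇔.refl

∀-Fin⇒∀-< : ∀ {m} {P : ℕ → Set} → (∀ (k : Fin m) → P (toℕ k)) → ∀ t → t < m → P t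
∀-Fin⇒∀-< {P = P} h t t<m = subst P (toℕ-fromℕ< t<m) (h (fromℕ< t<m))

module _ {t : ℤ} {m : ℕ} (S : ℕ → ℤ) (S-zero : S 0 ≡ 0ℤ) (S-end : S m ≡ t) where

  stayOrReflect⇔zeroOr :
    (∀ (k : Fin m) → StayOrReflect t (S (toℕ k)) (S (suc (toℕ k))))
    ⇔ (∀ (k : Fin m) → suc (toℕ k) < m → ZeroOr t (S (suc (toℕ k))))
  stayOrReflect⇔zeroOr = mk⇔
    (λ steps k _ → zeroOr-upTo (∀-Fin⇒∀-< steps) (suc (toℕ k)) (toℕ<n k))
    (λ inner k → zeroOr⇒stayOrReflect (zeroOr-all (∀-Fin⇒∀-< inner) (toℕ k) (ℕₚ.<⇒≤ (toℕ<n k)))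
                                      (zeroOr-all (∀-Fin⇒∀-< inner) (suc (toℕ k)) (toℕ<n k)))
    where
    zeroOr-upTo : (∀ u → u < m → StayOrReflect t (S u) (S (suc u))) → ∀ u → u ≤ m → ZeroOr t (S u)
    zeroOr-upTo steps zero    _   = inj₁ S-zero
    zeroOr-upTo steps (suc u) u<m =
      stayOrReflect-preserves-zeroOr (zeroOr-upTo steps u (ℕₚ.<⇒≤ u<m)) (steps u u<m)

    zeroOr-all : (∀ u → u < m → suc u < m → ZeroOr t (S (suc u))) → ∀ u → u ≤ m → ZeroOr t (S u)
    zeroOr-all inner zero    _    = inj₁ S-zero
    zeroOr-all inner (suc u) su≤m with ℕₚ.m≤n⇒m<n∨m≡n su≤m
    ... | inj₁ su<m = inner u su≤m su<m
    ... | inj₂ su≡m = inj₂ (trans (cong S su≡m) S-end)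

-- The flatness criterion

square≢0 : ∀ {d} → 1 ≤ d → + (d * d) ≢ 0ℤ
square≢0 (s≤s z≤n) ()

module Flatness (d : ℕ) {N : ℕ} (R : Parabolic N) (θ : Involution N) where
  open Blocks R

  P Q D : Fin (m R) → ℤ
  P i = + plusDim R θ i
  Q i = + minusDim R θ i
  D i = P i - Q i

  S : ℕ → ℤ
  S = ℤΣ.prefix D

  total : ℤ
  total = + dimPlus θ - + dimMinus θ

  c : ℤ
  c = + (d * d)

  multG multθ : Fin (m R) → Fin (m R) → ℕ
  multG i j = d * d * size R i * size R j
  multθ i j = d * d * (plusDim R θ i * plusDim R θ j + minusDim R θ i * minusDim R θ j)

  μG μθ : Fin (m R) → Fin (m R) → ℤ
  μG i j = + multG i j
  μθ i j = + multθ i j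

  S-zero : S 0 ≡ 0ℤ
  S-zero = ℤΣ.prefix-zero D

  sum-D : ℤΣ.sum D ≡ total
  sum-D = trans (sumWhere-distrib-- (λ _ → true) P Q)
                (cong₂ _-_ (cast (plusDim R θ) (sum-plusDim θ)) (cast (minusDim R θ) (sum-minusDim θ)))
    where
    cast : ∀ (f : Fin (m R) → ℕ) {n} → ℕΣ.sum f ≡ n → ℤΣ.sum (+_ ∘ f) ≡ + n
    cast f sum-f = trans (sym (+-Σℕ f)) (cong +_ (trans (Σℕ≡sum f) sum-f))

  S-end : S (m R) ≡ total
  S-end = trans (ℤΣ.prefix-full D ℕₚ.≤-refl) sum-D

  suffix-D : ∀ k → ℤΣ.suffix D k ≡ total - S (suc (toℕ k))
  suffix-D k = begin
    ℤΣ.suffix D k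
      ≡⟨ add-sub (S (suc (toℕ k))) _ ⟩
    S (suc (toℕ k)) +ℤ ℤΣ.suffix D k - S (suc (toℕ k))
      ≡⟨ cong (λ s → s +ℤ ℤΣ.suffix D k - S (suc (toℕ k))) (ℤΣ.prefix-suc D k) ⟩
    S (toℕ k) +ℤ D k +ℤ ℤΣ.suffix D k - S (suc (toℕ k))
      ≡⟨ cong (_- S (suc (toℕ k))) (ℤΣ.sum-split D k) ⟨
    ℤΣ.sum D - S (suc (toℕ k))
      ≡⟨ cong (_- S (suc (toℕ k))) sum-D ⟩
    total - S (suc (toℕ k)) ∎
    where
    open ≡-Reasoning
    add-sub : ∀ s x → x ≡ s +ℤ x - s
    add-sub = solve-∀

  partialDiff≡S : ∀ k → + partialPlus R θ k - + partialMinus R θ k ≡ S (suc (toℕ k))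
  partialDiff≡S k = begin
    + partialPlus R θ k - + partialMinus R θ k
      ≡⟨ cong₂ _-_ (+-Σℕ-where upTo-k (plusDim R θ)) (+-Σℕ-where upTo-k (minusDim R θ)) ⟩
    ℤΣ.sumWhere upTo-k P - ℤΣ.sumWhere upTo-k Q  ≡⟨ sumWhere-distrib-- upTo-k P Q ⟨
    ℤΣ.sumWhere upTo-k D
      ≡⟨ ℤΣ.sum-cong-≗ (λ i → cong (if_then D i else 0ℤ) (≤ᵇ≡<ᵇsuc (toℕ i) (toℕ k))) ⟩
    S (suc (toℕ k)) ∎
    where
    open ≡-Reasoning
    upTo-k : Fin (m R) → Bool
    upTo-k i = toℕ i ≤ᵇ toℕ k

  +size : ∀ i → + size R i ≡ P i +ℤ Q i
  +size i = trans (cong +_ (sym (plusDim+minusDim θ i))) (ℤₚ.pos-+ (plusDim R θ i) (minusDim R θ i))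

  μG-cast : ∀ i j → μG i j ≡ c *ℤ (P i +ℤ Q i) *ℤ (P j +ℤ Q j)
  μG-cast i j = begin
    + (d * d * size R i * size R j)        ≡⟨ ℤₚ.pos-* (d * d * size R i) (size R j) ⟩
    + (d * d * size R i) *ℤ + size R j      ≡⟨ cong (_*ℤ + size R j) (ℤₚ.pos-* (d * d) (size R i)) ⟩
    c *ℤ + size R i *ℤ + size R j            ≡⟨ cong₂ (λ x y → c *ℤ x *ℤ y) (+size i) (+size j) ⟩
    c *ℤ (P i +ℤ Q i) *ℤ (P j +ℤ Q j)        ∎
    where open ≡-Reasoning

  μθ-cast : ∀ i j → μθ i j ≡ c *ℤ (P i *ℤ P j +ℤ Q i *ℤ Q j)
  μθ-cast i j = begin
    μθ i j                                   ≡⟨ ℤₚ.pos-* (d * d) (p i * p j + q i * q j) ⟩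
    c *ℤ + (p i * p j + q i * q j)            ≡⟨ cong (c *ℤ_) (ℤₚ.pos-+ (p i * p j) (q i * q j)) ⟩
    c *ℤ (+ (p i * p j) +ℤ + (q i * q j))
      ≡⟨ cong₂ (λ x y → c *ℤ (x +ℤ y)) (ℤₚ.pos-* (p i) (p j)) (ℤₚ.pos-* (q i) (q j)) ⟩
    c *ℤ (P i *ℤ P j +ℤ Q i *ℤ Q j) ∎
    where
    open ≡-Reasoning
    p q : Fin (m R) → ℕ
    p = plusDim R θ
    q = minusDim R θ

  multiplicity : ∀ i j → μG i j +ℤ c *ℤ (D i *ℤ D j) ≡ μθ i j +ℤ μθ i j
  multiplicity i j = begin
    μG i j +ℤ c *ℤ (D i *ℤ D j)
      ≡⟨ cong (_+ℤ c *ℤ (D i *ℤ D j)) (μG-cast i j) ⟩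
    c *ℤ (P i +ℤ Q i) *ℤ (P j +ℤ Q j) +ℤ c *ℤ ((P i - Q i) *ℤ (P j - Q j))
      ≡⟨ polarise c (P i) (Q i) (P j) (Q j) ⟩
    c *ℤ (P i *ℤ P j +ℤ Q i *ℤ Q j) +ℤ c *ℤ (P i *ℤ P j +ℤ Q i *ℤ Q j)
      ≡⟨ cong₂ _+ℤ_ (μθ-cast i j) (μθ-cast i j) ⟨
    μθ i j +ℤ μθ i j ∎
    where
    open ≡-Reasoning
    polarise : ∀ c p q p′ q′ → c *ℤ (p +ℤ q) *ℤ (p′ +ℤ q′) +ℤ c *ℤ ((p - q) *ℤ (p′ - q′))
                               ≡ c *ℤ (p *ℤ p′ +ℤ q *ℤ q′) +ℤ c *ℤ (p *ℤ p′ +ℤ q *ℤ q′)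
    polarise = solve-∀

  rankOne-in-partialSums : ∀ k → c *ℤ (D k *ℤ (ℤΣ.suffix D k - S (toℕ k)))
                 ≡ c *ℤ ((S (suc (toℕ k)) - S (toℕ k)) *ℤ (total - (S (toℕ k) +ℤ S (suc (toℕ k)))))
  rankOne-in-partialSums k rewrite suffix-D k | ℤΣ.prefix-suc D k = regroup c (S (toℕ k)) (D k) total
    where
    regroup : ∀ c s δ t → c *ℤ (δ *ℤ (t - (s +ℤ δ) - s)) ≡ c *ℤ ((s +ℤ δ - s) *ℤ (t - (s +ℤ (s +ℤ δ))))
    regroup = solve-∀

  twoRho-decomposition : ∀ k →
    twoRhoG d R k +ℤ c *ℤ ((S (suc (toℕ k)) - S (toℕ k)) *ℤ (total - (S (toℕ k) +ℤ S (suc (toℕ k)))))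
      ≡ twoRhoθR d R θ k +ℤ twoRhoθR d R θ k
  twoRho-decomposition k = begin
    twoRhoG d R k +ℤ c *ℤ ((S (suc (toℕ k)) - S (toℕ k)) *ℤ (total - (S (toℕ k) +ℤ S (suc (toℕ k)))))
      ≡⟨ cong (twoRhoG d R k +ℤ_) (rankOne-in-partialSums k) ⟨
    twoRhoG d R k +ℤ c *ℤ (D k *ℤ (ℤΣ.suffix D k - S (toℕ k)))
      ≡⟨ cong₂ _+ℤ_ (twoRho≡twoRhoℤ multG k) (sym (twoRhoℤ-rankOne c D k)) ⟩
    twoRhoℤ μG k +ℤ twoRhoℤ (λ i j → c *ℤ (D i *ℤ D j)) k
      ≡⟨ twoRhoℤ-+ μG (λ i j → c *ℤ (D i *ℤ D j)) k ⟨
    twoRhoℤ (λ i j → μG i j +ℤ c *ℤ (D i *ℤ D j)) k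
      ≡⟨ twoRhoℤ-cong multiplicity k ⟩
    twoRhoℤ (λ i j → μθ i j +ℤ μθ i j) k
      ≡⟨ twoRhoℤ-+ μθ μθ k ⟩
    twoRhoℤ μθ k +ℤ twoRhoℤ μθ k
      ≡⟨ cong₂ _+ℤ_ (twoRho≡twoRhoℤ multθ k) (twoRho≡twoRhoℤ multθ k) ⟨
    twoRhoθR d R θ k +ℤ twoRhoθR d R θ k ∎
    where open ≡-Reasoning

  flatAt⇔stayOrReflect : 1 ≤ d → ∀ k →
    (twoRhoG d R k ≡ twoRhoθR d R θ k +ℤ twoRhoθR d R θ k)
      ⇔ StayOrReflect total (S (toℕ k)) (S (suc (toℕ k)))
  flatAt⇔stayOrReflect d≥1 k =
    ⇔.trans (x+y≡z⇒x≡z⇔y≡0 (twoRho-decomposition k)) (defect≡0⇔stayOrReflect _ _ (square≢0 d≥1))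

proposition3p5p7p1 : (d N : ℕ) → 1 ≤ d → (θ : Involution N) → (R : Parabolic N) →
    IsFlat d R θ θ ⇔
      (∀ (k : Fin (m R)) → suc (toℕ k) < m R →
        ((+ partialPlus R θ k) - (+ partialMinus R θ k) ≡ + 0)
        ⊎ ((+ partialPlus R θ k) - (+ partialMinus R θ k) ≡ (+ dimPlus θ) - (+ dimMinus θ)))
proposition3p5p7p1 d N d≥1 θ R =
  ⇔.trans (∀-cong-⇔ (flatAt⇔stayOrReflect d≥1))
  (⇔.trans (stayOrReflect⇔zeroOr S S-zero S-end)
           (∀-cong-⇔ λ k → →-cong-⇔ ⇔.refl (subst-⇔ (ZeroOr total) (sym (partialDiff≡S k)))))
  where open Flatness d R θ
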